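{- Let $\omega$ be a permutation and $\mathcal T=\mathcal T_\omega$ its tower diagram. Then $\pi_{\mathcal T}$ is a well-defined permutation of $\{1,\ldots,n\}$ (i.e. $\{f_1,\ldots,f_n\}=\{1,\ldots,n\}$), and $\omega=\pi_{\mathcal T}$.
   Context: Permutations are composed as functions, $(\sigma\tau)(x)=\sigma(\tau(x))$; $s_p=(p\ p+1)$. A tower diagram is a sequence $\mathcal T=(\mathcal T_1,\mathcal T_2,\ldots)$ of nonnegative integers, almost all zero. A cell is identified with the south-east corner $(a,b)$ ($a\ge1$, $b\ge0$) of the unit square $[a-1,a]\times[b,b+1]$; $(a,b)\in\mathcal T$ iff $b<\mathcal T_a$. The slide of $(a,b)$ is $a+b$; the top cell of a nonempty tower $p$ is $(p,\mathcal T_p-1)$. Sliding $i$ into $\mathcal T$: set $s:=i$ and examine towers $p=1,2,\ldots$ with $h=\mathcal T_p$: if $s>p+h$ go on; if $s=p+h$ increase $\mathcal T_p$ by one and stop; if $h\ge1$ and $s=p+h-1$ decrease $\mathcal T_p$ by one and stop; if $s<p+h-1$ set $s:=s+1$ and go on. The tower diagram $\mathcal T_\omega$ is obtained by sliding the letters of a reduced word $\alpha_1\cdots\alpha_l$ of $\omega=s_{\alpha_1}\cdots s_{\alpha_l}$, in order, into the empty diagram (independent of the reduced word). Flight paths: for a cell $c=(a,b)$, $\mathrm{fp}(\mathcal T,c)=\{c\}$ if $a=1$; if $a\ge2$, with $d=(a-1,b)$ and $e=(a-1,b+1)$, $\mathrm{fp}(\mathcal T,c)=\mathrm{fp}(\mathcal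 T,d)\cup\{c\}$ if $d\in\mathcal T$ and $\mathrm{fp}(\mathcal T,e)\cup\{c\}$ otherwise. If $(1,y)$ is the cell of $\mathrm{fp}(\mathcal T,c)$ in column $1$, the flight number is $\mathrm{fn}(\mathcal T,c)=1+y$. Let $n-1$ be the maximum of the slides of the top cells of $\mathcal T$ (for the empty diagram take this maximum to be $0$). For $p=1,\ldots,n$ let $x_p=(p,\mathcal T_p)$ be the lowest empty cell above tower $p$ and $f_p=\mathrm{fn}(\mathcal T,x_p)$. Define $\pi_{\mathcal T}$ on $\{f_1,\ldots,f_n\}$ by $\pi_{\mathcal T}(f_p)=p$. -}

module Defs where

open import Data.Nat using (ℕ; zero; suc; _+_; _∸_; _⊔_; _≡ᵇ_; _<ᵇ_; _≤_; _<_)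
open import Data.Bool using (Bool; true; false; if_then_else_; _∧_; not)
open import Data.List using (List; []; _∷_; foldl; length; replicate; _++_; [_])
open import Data.List.Relation.Unary.All using (All)
open import Relation.Binary.PropositionalEquality using (_≡_)
open import Relation.Nullary using (¬_)
open import Function using (id; _∘_)

-- simple transposition s_p = (p p+1) acting on ℕ (positions are 1,2,…; 0 is fixed)
s : ℕ → ℕ → ℕ
s p x = if x ≡ᵇ p then suc p else (if x ≡ᵇ suc p then p else x)

-- ω = s_{α₁} ⋯ s_{αₗ}, composed as functions: ω x = s_{α₁}(s_{α₂}(⋯ s_{αₗ}(x)))
wordPerm : List ℕ → ℕ → ℕ
wordPerm []       = id
wordPerm (a ∷ as) = s a ∘ wordPerm as

ValidWord : List ℕ → Set
ValidWord α = All (1 ≤_) α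

Reduced : List ℕ → Set
Reduced α = (β : List ℕ) → ValidWord β → length β < length α →
            ¬ ((x : ℕ) → wordPerm β x ≡ wordPerm α x)

-- Tower diagrams: the list (𝒯₁, 𝒯₂, …), all towers beyond the list being 0.
Tower : Set
Tower = List ℕ

-- height T p = 𝒯_p  (p ≥ 1; position 0 is junk 0)
height : Tower → ℕ → ℕ
height []      _             = 0
height (h ∷ T) zero          = 0
height (h ∷ T) (suc zero)    = h
height (h ∷ T) (suc (suc p)) = height T (suc p)

inT : Tower → ℕ → ℕ → Bool
inT T a b = b <ᵇ height T a

-- slideAt s p T : slide with current value s, examining towers p, p+1, … whose
-- heights form the list T.  Cases of the paper's algorithm, in order:
--   s > p+h : go on;  s = p+h : increase;  h ≥ 1, s = p+h-1 : decrease;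
--   s < p+h-1 : s := s+1, go on.
-- Beyond the list all towers are 0.  Situations where the paper's algorithm
-- is undefined or does not terminate (h = 0 and s < p) leave the diagram
-- unchanged (junk; unreachable for reduced words).
slideAt : ℕ → ℕ → Tower → Tower
slideAt s p [] = if p ≤ᵇ' s then replicate (s ∸ p) 0 ++ [ 1 ] else []
  where
  _≤ᵇ'_ : ℕ → ℕ → Bool
  m ≤ᵇ' n = m <ᵇ suc n
slideAt s p (h ∷ T) =
  if p + h <ᵇ s then h ∷ slideAt s (suc p) T
  else if s ≡ᵇ p + h then suc h ∷ T
  else if (1 <ᵇ suc h) ∧ (s ≡ᵇ p + h ∸ 1) then (h ∸ 1) ∷ T
  else if suc s <ᵇ p + h then h ∷ slideAt (suc s) (suc p) T
  else h ∷ T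

slide : ℕ → Tower → Tower
slide i T = slideAt i 1 T

towerDiagram : List ℕ → Tower
towerDiagram α = foldl (λ T a → slide a T) [] α

-- flight number fn(T,(a,b)) for a ≥ 1 (a = 0 is junk)
fn : Tower → ℕ → ℕ → ℕ
fn T zero          b = 0
fn T (suc zero)    b = suc b
fn T (suc (suc a)) b =
  if inT T (suc a) b then fn T (suc a) b else fn T (suc a) (suc b)

maxTopSlide : ℕ → Tower → ℕ
maxTopSlide p []      = 0
maxTopSlide p (h ∷ T) =
  (if h ≡ᵇ 0 then 0 else p + h ∸ 1) ⊔ maxTopSlide (suc p) T

-- n, where n - 1 is the maximal slide of a top cell
nT : Tower → ℕ
nT T = suc (maxTopSlide 1 T)

-- f_p = fn(T, x_p) with x_p = (p, 𝒯_p)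
fT : Tower → ℕ → ℕ
fT T p = fn T p (height T p)

module Submission where

-- Let  code ω q = #{ i < ω⁻¹ q | ω i ≥ q }  (an inverse Lehmer code).
--  1. Multiplying ω on the right by s_a, where a is an ascent (ω a < ω (a+1)),
--     raises the code at ω a by one and changes no other code; a descent
--     lowers the code at ω (a+1).  So every letter changes the total code (the
--     number of inversions) by one, and appending descents until the identity
--     shows that a reduced word is no longer than its number of inversions.
--     Hence each letter of a reduced word is an ascent of the preceding prefix.
--  2. Sliding an ascent a into a diagram whose heights are the codes stacks a
--     single cell on tower ω a, so the heights of 𝒯_ω are the codes of ω.
--  3. In such a diagram the flight path from the cell above tower p lands in
--     row ω⁻¹ p - 1 of column 1, i.e. f_p = ω⁻¹ p; and a tower p = ω x < x
--     has height ≥ x - p, which forces x ≤ n: ω moves nothing above n down,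
--     hence fixes every point above n.

open import Defs
open import Data.Nat
open import Data.Nat.Properties
open import Data.Nat.ListAction using (sum)
open import Data.Nat.Solver using (module +-*-Solver)
open import Data.Bool using (Bool; true; false)
open import Data.Bool.Properties using (∧-zeroʳ)
open import Data.Empty using (⊥-elim)
open import Data.Product using (_×_; Σ-syntax; _,_; proj₁)
import Data.Product as Product
open import Data.Sum using (_⊎_; inj₁; inj₂)
open import Data.List using (List; []; _∷_; _∷ʳ_; _++_; [_]; foldl; length; replicate)
open import Data.List.Properties using (length-++)
open import Data.List.Relation.Unary.All using (All; []; _∷_)
import Data.List.Relation.Unary.All as All
open import Data.List.Relation.Unary.All.Properties using (∷ʳ⁺; ∷ʳ⁻)
open import Data.List.Reverse using (Reverse; reverseView; []; _∶_∶ʳ_)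
open import Function using (_∘_; id)
open import Relation.Binary.Definitions using (Tri; tri<; tri≈; tri>)
open import Relation.Binary.PropositionalEquality
  using (_≡_; _≢_; refl; sym; trans; cong; cong₂; subst; subst₂; module ≡-Reasoning)
open import Relation.Nullary using (¬_; yes; no)
open import Relation.Nullary.Decidable using (dec-true; dec-false; _×-dec_)

<ᵇ-true : ∀ {m n} → m < n → (m <ᵇ n) ≡ true
<ᵇ-true {m} {n} = dec-true (m <? n)

<ᵇ-false : ∀ {m n} → ¬ m < n → (m <ᵇ n) ≡ false
<ᵇ-false {m} {n} = dec-false (m <? n)

≤ᵇ-true : ∀ {m n} → m ≤ n → (m ≤ᵇ n) ≡ true
≤ᵇ-true {m} {n} = dec-true (m ≤? n)

≤ᵇ-false : ∀ {m n} → n < m → (m ≤ᵇ n) ≡ false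
≤ᵇ-false {m} {n} n<m = dec-false (m ≤? n) (<⇒≱ n<m)

≡ᵇ-true : ∀ {m n} → m ≡ n → (m ≡ᵇ n) ≡ true
≡ᵇ-true {m} {n} = dec-true (m ≟ n)

≡ᵇ-false : ∀ {m n} → m ≢ n → (m ≡ᵇ n) ≡ false
≡ᵇ-false {m} {n} = dec-false (m ≟ n)

ind : Bool → ℕ
ind true  = 1
ind false = 0

ind≤1 : ∀ b → ind b ≤ 1
ind≤1 true  = ≤-refl
ind≤1 false = z≤n

ind-≤-split : ∀ q x → ind (q ≤ᵇ x) ≡ ind (suc q ≤ᵇ x) + ind (x ≡ᵇ q)
ind-≤-split q x with <-cmp q x
... | tri< q<x q≢x _ rewrite ≤ᵇ-true (<⇒≤ q<x) | ≤ᵇ-true q<x | ≡ᵇ-false (q≢x ∘ sym) = refl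
... | tri≈ _ refl _ rewrite ≤ᵇ-true (≤-refl {q}) | ≤ᵇ-false (n<1+n q) | ≡ᵇ-true (refl {x = q}) = refl
... | tri> _ q≢x x<q rewrite ≤ᵇ-false x<q | ≤ᵇ-false (m<n⇒m<1+n x<q) | ≡ᵇ-false (q≢x ∘ sym) = refl

sum< : (ℕ → ℕ) → ℕ → ℕ
sum< f zero    = 0
sum< f (suc j) = sum< f j + f j

sum<-cong : ∀ {f g} j → (∀ i → i < j → f i ≡ g i) → sum< f j ≡ sum< g j
sum<-cong zero    eq = refl
sum<-cong (suc j) eq =
  cong₂ _+_ (sum<-cong j (λ i i<j → eq i (m<n⇒m<1+n i<j))) (eq j ≤-refl)

sum<-ext : ∀ {f g} j → (∀ i → f i ≡ g i) → sum< f j ≡ sum< g j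
sum<-ext j eq = sum<-cong j (λ i _ → eq i)

sum<-zero : ∀ {f} j → (∀ i → f i ≡ 0) → sum< f j ≡ 0
sum<-zero zero    eq = refl
sum<-zero (suc j) eq rewrite sum<-zero j eq | eq j = refl

sum<-+ : ∀ f g j → sum< (λ i → f i + g i) j ≡ sum< f j + sum< g j
sum<-+ f g zero    = refl
sum<-+ f g (suc j) rewrite sum<-+ f g j =
  solve 4 (λ F G x y → (F :+ G) :+ (x :+ y) := (F :+ x) :+ (G :+ y)) refl
        (sum< f j) (sum< g j) (f j) (g j)
  where open +-*-Solver

sum<-mono : ∀ f {j k} → j ≤ k → sum< f j ≤ sum< f k
sum<-mono f {j} {zero}  z≤n = ≤-refl
sum<-mono f {j} {suc k} j≤k+1 with m≤n⇒m<n∨m≡n j≤k+1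
... | inj₁ j<k+1 = ≤-trans (sum<-mono f (≤-pred j<k+1)) (m≤m+n (sum< f k) (f k))
... | inj₂ refl  = ≤-refl

s-left : ∀ p → s p p ≡ suc p
s-left p rewrite ≡ᵇ-true (refl {x = p}) = refl

s-right : ∀ p → s p (suc p) ≡ p
s-right p rewrite ≡ᵇ-false (1+n≢n {p}) | ≡ᵇ-true (refl {x = suc p}) = refl

s-fix : ∀ {p x} → x ≢ p → x ≢ suc p → s p x ≡ x
s-fix x≢p x≢p+1 rewrite ≡ᵇ-false x≢p | ≡ᵇ-false x≢p+1 = refl

s-involutive : ∀ p x → s p (s p x) ≡ x
s-involutive p x with x ≟ p | x ≟ suc p
... | yes refl | _      = trans (cong (s p) (s-left p)) (s-right p)
... | no _     | yes refl = trans (cong (s p) (s-right p)) (s-left p)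
... | no x≢p   | no x≢p+1 = trans (cong (s p) (s-fix x≢p x≢p+1)) (s-fix x≢p x≢p+1)

sum<-swap : ∀ f a j → j ≢ suc a → sum< (f ∘ s a) j ≡ sum< f j
sum<-swap f a zero    _ = refl
sum<-swap f a (suc j) j+1≢a+1 with <-cmp j a
... | tri< j<a _ _ =
  cong₂ _+_ (sum<-swap f a j (<⇒≢ (m<n⇒m<1+n j<a)))
            (cong f (s-fix (<⇒≢ j<a) (<⇒≢ (m<n⇒m<1+n j<a))))
... | tri≈ _ j≡a _ = ⊥-elim (j+1≢a+1 (cong suc j≡a))
... | tri> _ _ a<j with m≤n⇒m<n∨m≡n a<j
...   | inj₁ a+1<j =
  cong₂ _+_ (sum<-swap f a j (>⇒≢ a+1<j))
            (cong f (s-fix (>⇒≢ a<j) (>⇒≢ a+1<j)))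
...   | inj₂ refl
  rewrite s-left a | s-right a | sum<-swap f a a (<⇒≢ (n<1+n a)) =
  trans (+-assoc (sum< f a) _ _)
        (trans (cong (sum< f a +_) (+-comm (f (suc a)) (f a))) (sym (+-assoc (sum< f a) _ _)))

sum<-swap-mid : ∀ f a → sum< (f ∘ s a) (suc a) ≡ sum< f a + f (suc a)
sum<-swap-mid f a rewrite s-left a = cong (_+ f (suc a)) (sum<-swap f a a (<⇒≢ (n<1+n a)))

record Perm : Set where
  field
    to from : ℕ → ℕ
    to-from : ∀ x → to (from x) ≡ x
    from-to : ∀ x → from (to x) ≡ x

open Perm

to-injective : ∀ π {x y} → to π x ≡ to π y → x ≡ y
to-injective π {x} {y} eq = trans (sym (from-to π x)) (trans (cong (from π) eq) (from-to π y))

ascent-or-descent : ∀ π a → to π a < to π (suc a) ⊎ to π (suc a) < to π a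
ascent-or-descent π a with <-cmp (to π a) (to π (suc a))
... | tri< asc _ _  = inj₁ asc
... | tri≈ _ eq _   = ⊥-elim (<-irrefl (to-injective π eq) (n<1+n a))
... | tri> _ _ desc = inj₂ desc

_·s_ : Perm → ℕ → Perm
π ·s a = record
  { to      = to π ∘ s a
  ; from    = s a ∘ from π
  ; to-from = λ x → trans (cong (to π) (s-involutive a (from π x))) (to-from π x)
  ; from-to = λ x → trans (cong (s a) (from-to π (s a x))) (s-involutive a x)
  }

module _ (π : Perm) (to-0 : to π 0 ≡ 0) where

  from-0 : from π 0 ≡ 0
  from-0 = trans (cong (from π) (sym to-0)) (from-to π 0)

  to-pos : ∀ {x} → 1 ≤ x → 1 ≤ to π x
  to-pos 1≤x = n≢0⇒n>0 (λ πx≡0 → <⇒≢ 1≤x (sym (to-injective π (trans πx≡0 (sym to-0)))))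

  from-pos : ∀ {x} → 1 ≤ x → 1 ≤ from π x
  from-pos {x} 1≤x = n≢0⇒n>0 (λ eq → <⇒≢ 1≤x (sym (trans (sym (to-from π x)) (trans (cong (to π) eq) to-0))))

module _ (π : Perm) {B : ℕ} (fix : ∀ x → B < x → to π x ≡ x) where

  to-≤ : ∀ {y} → y ≤ B → to π y ≤ B
  to-≤ {y} y≤B = ≮⇒≥ (λ B<πy → <⇒≱ B<πy (subst (_≤ B) (sym (to-injective π (fix (to π y) B<πy))) y≤B))

  from-≤ : ∀ {y} → y ≤ B → from π y ≤ B
  from-≤ {y} y≤B = ≮⇒≥ (λ B<π⁻y →
    <⇒≱ B<π⁻y (subst (_≤ B) (trans (sym (to-from π y)) (fix (from π y) B<π⁻y)) y≤B))

  fix-above : ∀ {n} → (∀ x → n < x → x ≤ to π x) → ∀ x → n < x → to π x ≡ x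
  fix-above {n} rising x n<x = go (suc B) x n<x (<-≤-trans (n<1+n B) (m≤n+m (suc B) x))
    where
    go : ∀ k x → n < x → B < x + k → to π x ≡ x
    go zero    x n<x B<x+0 = fix x (subst (B <_) (+-identityʳ x) B<x+0)
    go (suc k) x n<x B<x+k+1 with m≤n⇒m<n∨m≡n (rising x n<x)
    ... | inj₂ x≡πx = sym x≡πx
    ... | inj₁ x<πx = ⊥-elim (<⇒≢ x<πx (sym (to-injective π (go k (to π x) (<-trans n<x x<πx) B<πx+k))))
      where
      B<πx+k : B < to π x + k
      B<πx+k = <-≤-trans B<x+k+1 (≤-trans (≤-reflexive (+-suc x k)) (+-monoˡ-≤ k x<πx))

count≥ : (ℕ → ℕ) → ℕ → ℕ → ℕ
count≥ ω q = sum< (λ i → ind (q ≤ᵇ ω i))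

count≥-hit : ∀ ω q j → q ≤ ω j → count≥ ω q (suc j) ≡ suc (count≥ ω q j)
count≥-hit ω q j q≤ωj rewrite ≤ᵇ-true q≤ωj = +-comm (count≥ ω q j) 1

count≥-hit< : ∀ ω q {j k} → q ≤ ω j → j < k → count≥ ω q j < count≥ ω q k
count≥-hit< ω q {j} q≤ωj j<k =
  <-≤-trans (≤-reflexive (sym (count≥-hit ω q j q≤ωj))) (sum<-mono _ j<k)

count≥-zero : ∀ ω j → count≥ ω 0 j ≡ j
count≥-zero ω zero    = refl
count≥-zero ω (suc j) = trans (cong (_+ 1) (count≥-zero ω j)) (+-comm j 1)

module _ (π : Perm) where

  count-value : ∀ q j → sum< (λ i → ind (to π i ≡ᵇ q)) j ≡ ind (from π q <ᵇ j)
  count-value q zero    = refl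
  count-value q (suc j) = trans (cong (_+ ind (to π j ≡ᵇ q)) (count-value q j)) (step (<-cmp (from π q) j))
    where
    step : Tri (from π q < j) (from π q ≡ j) (from π q > j) →
           ind (from π q <ᵇ j) + ind (to π j ≡ᵇ q) ≡ ind (from π q <ᵇ suc j)
    step (tri< lt _ _) rewrite <ᵇ-true lt | <ᵇ-true (m<n⇒m<1+n lt)
      | ≡ᵇ-false (λ πj≡q → <⇒≢ lt (trans (cong (from π) (sym πj≡q)) (from-to π j))) = refl
    step (tri≈ _ eq _) rewrite <ᵇ-false (<-irrefl eq) | <ᵇ-true (≤-reflexive (cong suc eq))
      | ≡ᵇ-true (trans (cong (to π) (sym eq)) (to-from π q)) = refl
    step (tri> _ _ gt) rewrite <ᵇ-false (<⇒≯ gt) | <ᵇ-false (≤⇒≯ gt)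
      | ≡ᵇ-false (λ πj≡q → >⇒≢ gt (trans (cong (from π) (sym πj≡q)) (from-to π j))) = refl

  count≥-split : ∀ q j → count≥ (to π) q j ≡ count≥ (to π) (suc q) j + ind (from π q <ᵇ j)
  count≥-split q j = begin
    count≥ (to π) q j
      ≡⟨ sum<-ext j (λ i → ind-≤-split q (to π i)) ⟩
    sum< (λ i → ind (suc q ≤ᵇ to π i) + ind (to π i ≡ᵇ q)) j
      ≡⟨ sum<-+ _ _ j ⟩
    count≥ (to π) (suc q) j + sum< (λ i → ind (to π i ≡ᵇ q)) j
      ≡⟨ cong (count≥ (to π) (suc q) j +_) (count-value q j) ⟩
    count≥ (to π) (suc q) j + ind (from π q <ᵇ j) ∎
    where open ≡-Reasoning

  count≥-lower : ∀ q j → j ≤ count≥ (to π) q j + q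
  count≥-lower zero    j = ≤-reflexive (sym (trans (+-identityʳ _) (count≥-zero (to π) j)))
  count≥-lower (suc q) j = begin
    j                                                          ≤⟨ count≥-lower q j ⟩
    count≥ (to π) q j + q                                      ≡⟨ cong (_+ q) (count≥-split q j) ⟩
    count≥ (to π) (suc q) j + ind (from π q <ᵇ j) + q          ≤⟨ +-monoˡ-≤ q (+-monoʳ-≤ _ (ind≤1 _)) ⟩
    count≥ (to π) (suc q) j + 1 + q                            ≡⟨ +-assoc (count≥ (to π) (suc q) j) 1 q ⟩
    count≥ (to π) (suc q) j + suc q                            ∎
    where open ≤-Reasoning

  count≥-one : to π 0 ≡ 0 → ∀ j → count≥ (to π) 1 (suc j) ≡ j
  count≥-one to-0 j = +-cancelʳ-≡ 1 _ j (sym (begin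
    j + 1                                                 ≡⟨ +-comm j 1 ⟩
    suc j                                                 ≡⟨ sym (count≥-zero (to π) (suc j)) ⟩
    count≥ (to π) 0 (suc j)                               ≡⟨ count≥-split 0 (suc j) ⟩
    count≥ (to π) 1 (suc j) + ind (from π 0 <ᵇ suc j)
      ≡⟨ cong (λ x → count≥ (to π) 1 (suc j) + ind (x <ᵇ suc j)) (from-0 π to-0) ⟩
    count≥ (to π) 1 (suc j) + 1                           ∎))
    where open ≡-Reasoning

idPerm : Perm
idPerm = record { to = id ; from = id ; to-from = λ _ → refl ; from-to = λ _ → refl }

-- The code of π at q: the number of positions before π⁻¹ q that carry a value
-- ≥ q (equivalently > q).  It turns out to be the height of tower q of 𝒯_π.
code : Perm → ℕ → ℕ
code π q = count≥ (to π) q (from π q)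

code-cong : ∀ π ρ → (∀ x → to π x ≡ to ρ x) → (∀ x → from π x ≡ from ρ x) →
            ∀ q → code π q ≡ code ρ q
code-cong π ρ to-eq from-eq q rewrite from-eq q =
  sum<-ext (from ρ q) (λ i → cong (λ y → ind (q ≤ᵇ y)) (to-eq i))

code-ascent : ∀ π a → to π a < to π (suc a) →
              ∀ q → code (π ·s a) q ≡ code π q + ind (q ≡ᵇ to π a)
code-ascent π a asc q with from π q ≟ a | from π q ≟ suc a
... | yes π⁻q≡a | _ = begin
  sum< (g ∘ s a) (s a (from π q))   ≡⟨ cong (λ j → sum< (g ∘ s a) (s a j)) π⁻q≡a ⟩
  sum< (g ∘ s a) (s a a)            ≡⟨ cong (sum< (g ∘ s a)) (s-left a) ⟩
  sum< (g ∘ s a) (suc a)            ≡⟨ sum<-swap-mid g a ⟩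
  sum< g a + g (suc a)              ≡⟨ cong (λ b → sum< g a + ind b)
                                              (≤ᵇ-true (subst (_≤ to π (suc a)) (sym q≡πa) (<⇒≤ asc))) ⟩
  sum< g a + 1                      ≡⟨ cong₂ (λ j b → sum< g j + ind b) (sym π⁻q≡a) (sym (≡ᵇ-true q≡πa)) ⟩
  sum< g (from π q) + ind (q ≡ᵇ to π a) ∎
  where
  open ≡-Reasoning
  g : ℕ → ℕ
  g i = ind (q ≤ᵇ to π i)
  q≡πa : q ≡ to π a
  q≡πa = trans (sym (to-from π q)) (cong (to π) π⁻q≡a)
... | no _ | yes π⁻q≡a+1 = begin
  sum< (g ∘ s a) (s a (from π q))   ≡⟨ cong (λ j → sum< (g ∘ s a) (s a j)) π⁻q≡a+1 ⟩
  sum< (g ∘ s a) (s a (suc a))      ≡⟨ cong (sum< (g ∘ s a)) (s-right a) ⟩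
  sum< (g ∘ s a) a                  ≡⟨ sum<-swap g a a (<⇒≢ (n<1+n a)) ⟩
  sum< g a                          ≡⟨ sym (+-identityʳ _) ⟩
  sum< g a + 0                      ≡⟨ cong (λ b → sum< g a + ind b) (sym (≤ᵇ-false (subst (to π a <_) (sym q≡πa+1) asc))) ⟩
  sum< g (suc a)                    ≡⟨ sym (+-identityʳ _) ⟩
  sum< g (suc a) + 0                ≡⟨ cong₂ (λ j b → sum< g j + ind b) (sym π⁻q≡a+1)
                                               (sym (≡ᵇ-false (λ q≡πa → <⇒≢ asc (trans (sym q≡πa) q≡πa+1)))) ⟩
  sum< g (from π q) + ind (q ≡ᵇ to π a) ∎
  where
  open ≡-Reasoning
  g : ℕ → ℕ
  g i = ind (q ≤ᵇ to π i)
  q≡πa+1 : q ≡ to π (suc a)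
  q≡πa+1 = trans (sym (to-from π q)) (cong (to π) π⁻q≡a+1)
... | no π⁻q≢a | no π⁻q≢a+1
  rewrite s-fix π⁻q≢a π⁻q≢a+1
        | ≡ᵇ-false {q} {to π a} (λ q≡πa → π⁻q≢a (trans (cong (from π) q≡πa) (from-to π a))) =
  trans (sum<-swap _ a (from π q) π⁻q≢a+1) (sym (+-identityʳ _))

-- Multiplying by a descent a of π removes one from the code at π (a + 1); this
-- is the ascent case for π ·s a, since (π ·s a) ·s a = π.
code-descent : ∀ π a → to π (suc a) < to π a →
               ∀ q → code (π ·s a) q + ind (q ≡ᵇ to π (suc a)) ≡ code π q
code-descent π a desc q = begin
  code (π ·s a) q + ind (q ≡ᵇ to π (suc a))     ≡⟨ cong (λ x → code (π ·s a) q + ind (q ≡ᵇ to π x)) (sym (s-left a)) ⟩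
  code (π ·s a) q + ind (q ≡ᵇ to (π ·s a) a)    ≡⟨ sym (code-ascent (π ·s a) a asc q) ⟩
  code ((π ·s a) ·s a) q                        ≡⟨ code-cong ((π ·s a) ·s a) π (λ x → cong (to π) (s-involutive a x))
                                                                                (λ x → s-involutive a (from π x)) q ⟩
  code π q                                      ∎
  where
  open ≡-Reasoning
  asc : to π (s a a) < to π (s a (suc a))
  asc rewrite s-left a | s-right a = desc

-- The total code over the values below N, i.e. the number of inversions of π
-- once N exceeds every point moved by π.
totalCode : Perm → ℕ → ℕ
totalCode π N = sum< (code π) N

sum<-point : ∀ (f : ℕ → ℕ) u N → u < N → sum< (λ q → f q + ind (q ≡ᵇ u)) N ≡ sum< f N + 1
sum<-point f u N u<N = begin
  sum< (λ q → f q + ind (q ≡ᵇ u)) N          ≡⟨ sum<-+ f _ N ⟩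
  sum< f N + sum< (λ q → ind (q ≡ᵇ u)) N     ≡⟨ cong (sum< f N +_) (count-value idPerm u N) ⟩
  sum< f N + ind (u <ᵇ N)                    ≡⟨ cong (λ b → sum< f N + ind b) (<ᵇ-true u<N) ⟩
  sum< f N + 1                               ∎
  where open ≡-Reasoning

totalCode-ascent : ∀ π a N → to π a < to π (suc a) → to π a < N →
                   totalCode (π ·s a) N ≡ totalCode π N + 1
totalCode-ascent π a N asc πa<N =
  trans (sum<-ext N (code-ascent π a asc)) (sum<-point (code π) (to π a) N πa<N)

totalCode-descent : ∀ π a N → to π (suc a) < to π a → to π (suc a) < N →
                    totalCode (π ·s a) N + 1 ≡ totalCode π N
totalCode-descent π a N desc πa+1<N =
  trans (sym (sum<-point (code (π ·s a)) (to π (suc a)) N πa+1<N)) (sum<-ext N (code-descent π a desc))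

wordInv : List ℕ → ℕ → ℕ
wordInv []      x = x
wordInv (a ∷ β) x = wordInv β (s a x)

wordP : List ℕ → Perm
wordP β = record { to = wordPerm β ; from = wordInv β ; to-from = to-from′ β ; from-to = from-to′ β }
  where
  to-from′ : ∀ β x → wordPerm β (wordInv β x) ≡ x
  to-from′ []      x = refl
  to-from′ (a ∷ β) x = trans (cong (s a) (to-from′ β (s a x))) (s-involutive a x)
  from-to′ : ∀ β x → wordInv β (wordPerm β x) ≡ x
  from-to′ []      x = refl
  from-to′ (a ∷ β) x = trans (cong (wordInv β) (s-involutive a (wordPerm β x))) (from-to′ β x)

wordPerm-snoc : ∀ β a x → wordPerm (β ∷ʳ a) x ≡ wordPerm β (s a x)
wordPerm-snoc []      a x = refl
wordPerm-snoc (b ∷ β) a x = cong (s b) (wordPerm-snoc β a x)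

wordInv-snoc : ∀ β a x → wordInv (β ∷ʳ a) x ≡ s a (wordInv β x)
wordInv-snoc []      a x = refl
wordInv-snoc (b ∷ β) a x = wordInv-snoc β a (s b x)

code-snoc : ∀ β a q → code (wordP (β ∷ʳ a)) q ≡ code (wordP β ·s a) q
code-snoc β a = code-cong (wordP (β ∷ʳ a)) (wordP β ·s a) (wordPerm-snoc β a) (wordInv-snoc β a)

totalCode-snoc : ∀ β a N → totalCode (wordP (β ∷ʳ a)) N ≡ totalCode (wordP β ·s a) N
totalCode-snoc β a N = sum<-ext N (code-snoc β a)

towerDiagram-snoc : ∀ β a → towerDiagram (β ∷ʳ a) ≡ slide a (towerDiagram β)
towerDiagram-snoc β a = foldl-snoc [] β
  where
  foldl-snoc : ∀ 𝒯 β → foldl (λ 𝒯 a → slide a 𝒯) 𝒯 (β ∷ʳ a) ≡ slide a (foldl (λ 𝒯 a → slide a 𝒯) 𝒯 β)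
  foldl-snoc 𝒯 []      = refl
  foldl-snoc 𝒯 (b ∷ β) = foldl-snoc (slide b 𝒯) β

Letters≤ : ℕ → List ℕ → Set
Letters≤ M = All (λ a → 1 ≤ a × a ≤ M)

letters≤sum : ∀ α → ValidWord α → Letters≤ (sum α) α
letters≤sum []      []          = []
letters≤sum (a ∷ α) (1≤a ∷ valid) =
  (1≤a , m≤m+n a (sum α)) ∷ All.map (Product.map₂ (λ b≤Σα → ≤-trans b≤Σα (m≤n+m (sum α) a))) (letters≤sum α valid)

module _ {M : ℕ} where

  wordPerm-0 : ∀ β → Letters≤ M β → wordPerm β 0 ≡ 0
  wordPerm-0 []      []                  = refl
  wordPerm-0 (a ∷ β) ((1≤a , _) ∷ bound) rewrite wordPerm-0 β bound = s-fix (<⇒≢ 1≤a) (λ ())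

  wordPerm-large : ∀ β → Letters≤ M β → ∀ x → suc M < x → wordPerm β x ≡ x
  wordPerm-large []      []                  x M+1<x = refl
  wordPerm-large (a ∷ β) ((_ , a≤M) ∷ bound) x M+1<x rewrite wordPerm-large β bound x M+1<x =
    s-fix (>⇒≢ (≤-<-trans (m≤n⇒m≤1+n a≤M) M+1<x)) (>⇒≢ (≤-<-trans (s≤s a≤M) M+1<x))

code-identity : ∀ q → code (wordP []) q ≡ 0
code-identity q = trans (sum<-cong q (λ i i<q → cong ind (≤ᵇ-false i<q))) (sum<-zero q (λ _ → refl))

-- Reduced words.  For words with letters in 1, …, M all values of the
-- permutation lie in 0, …, M + 1, so the total code over the values below
-- M + 2 is the number of inversions.
module _ (M : ℕ) where

  inversions : List ℕ → ℕ
  inversions β = totalCode (wordP β) (2 + M)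

  inversions-[] : inversions [] ≡ 0
  inversions-[] = sum<-zero (2 + M) code-identity

  wordPerm-< : ∀ β → Letters≤ M β → ∀ {x} → x ≤ suc M → wordPerm β x < 2 + M
  wordPerm-< β bound x≤M+1 = s≤s (to-≤ (wordP β) (wordPerm-large β bound) x≤M+1)

  inversions-ascent : ∀ β a → Letters≤ M β → a ≤ M → wordPerm β a < wordPerm β (suc a) →
                      inversions (β ∷ʳ a) ≡ inversions β + 1
  inversions-ascent β a bound a≤M asc =
    trans (totalCode-snoc β a (2 + M))
          (totalCode-ascent (wordP β) a (2 + M) asc (wordPerm-< β bound (m≤n⇒m≤1+n a≤M)))

  inversions-descent : ∀ β a → Letters≤ M β → a ≤ M → wordPerm β (suc a) < wordPerm β a →
                       inversions (β ∷ʳ a) + 1 ≡ inversions β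
  inversions-descent β a bound a≤M desc =
    trans (cong (_+ 1) (totalCode-snoc β a (2 + M)))
          (totalCode-descent (wordP β) a (2 + M) desc (wordPerm-< β bound (s≤s a≤M)))

  -- Each letter changes the number of inversions by one.
  inversions≤length : ∀ β → Letters≤ M β → inversions β ≤ length β
  inversions≤length β = go (reverseView β)
    where
    go : ∀ {β} → Reverse β → Letters≤ M β → inversions β ≤ length β
    go []           _     = ≤-reflexive inversions-[]
    go (β ∶ r ∶ʳ a) bound with ∷ʳ⁻ bound
    ... | boundβ , (_ , a≤M) rewrite length-++ β {[ a ]}
      with ascent-or-descent (wordP β) a
    ...   | inj₁ asc  = ≤-trans (≤-reflexive (inversions-ascent β a boundβ a≤M asc)) (+-monoˡ-≤ 1 (go r boundβ))
    ...   | inj₂ desc = begin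
      inversions (β ∷ʳ a)      ≤⟨ m≤m+n _ 1 ⟩
      inversions (β ∷ʳ a) + 1  ≡⟨ inversions-descent β a boundβ a≤M desc ⟩
      inversions β             ≤⟨ go r boundβ ⟩
      length β                 ≤⟨ m≤m+n _ 1 ⟩
      length β + 1             ∎
      where open ≤-Reasoning

  no-descent⇒identity : ∀ β → Letters≤ M β →
    (∀ a → 1 ≤ a → a ≤ M → wordPerm β a < wordPerm β (suc a)) → ∀ x → wordPerm β x ≡ x
  no-descent⇒identity β bound asc zero    = wordPerm-0 β bound
  no-descent⇒identity β bound asc (suc x) =
    fix-above (wordP β) (wordPerm-large β bound) (λ { zero () ; (suc y) _ → rising y }) (suc x) (s≤s z≤n)
    where
    -- Positive points are not moved down: 1 ≤ ω 1 < ω 2 < ⋯ < ω (M + 1).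
    rising : ∀ y → suc y ≤ wordPerm β (suc y)
    rising zero    = to-pos (wordP β) (wordPerm-0 β bound) (s≤s z≤n)
    rising (suc y) with suc y ≤? M
    ... | yes y+1≤M = ≤-<-trans (rising y) (asc (suc y) (s≤s z≤n) y+1≤M)
    ... | no  y+1≰M = ≤-reflexive (sym (wordPerm-large β bound (suc (suc y)) (s≤s (≰⇒> y+1≰M))))

  descent-or-identity : ∀ β → Letters≤ M β →
    (Σ[ a ∈ ℕ ] (1 ≤ a × a ≤ M × wordPerm β (suc a) < wordPerm β a)) ⊎ (∀ x → wordPerm β x ≡ x)
  descent-or-identity β bound
    with anyUpTo? (λ a → 1 ≤? a ×-dec wordPerm β (suc a) <? wordPerm β a) (suc M)
  ... | yes (a , a<M+1 , 1≤a , desc) = inj₁ (a , 1≤a , ≤-pred a<M+1 , desc)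
  ... | no none = inj₂ (no-descent⇒identity β bound ascent)
    where
    ascent : ∀ a → 1 ≤ a → a ≤ M → wordPerm β a < wordPerm β (suc a)
    ascent a 1≤a a≤M with ascent-or-descent (wordP β) a
    ... | inj₁ asc  = asc
    ... | inj₂ desc = ⊥-elim (none (a , s≤s a≤M , 1≤a , desc))

  -- Appending descents until the identity is reached lowers the number of
  -- inversions each time: every permutation has a word of length at most its
  -- number of inversions.
  shorten : ∀ k β → Letters≤ M β → inversions β ≡ k →
    Σ[ γ ∈ List ℕ ] (Letters≤ M γ × length γ ≤ k × (∀ x → wordPerm γ x ≡ wordPerm β x))
  shorten k β bound inv≡k with descent-or-identity β bound
  ... | inj₂ identity = [] , [] , z≤n , λ x → sym (identity x)
  ... | inj₁ (a , 1≤a , a≤M , desc) with k | trans (+-comm 1 _) (trans (inversions-descent β a bound a≤M desc) inv≡k)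
  ...   | zero  | 1+inv≡0 = ⊥-elim (1+n≢0 1+inv≡0)
  ...   | suc k | 1+inv≡k+1 with shorten k (β ∷ʳ a) (∷ʳ⁺ bound (1≤a , a≤M)) (suc-injective 1+inv≡k+1)
  ...     | γ , boundγ , γ≤k , same =
    γ ∷ʳ a , ∷ʳ⁺ boundγ (1≤a , a≤M) ,
    ≤-trans (≤-reflexive (trans (length-++ γ) (+-comm (length γ) 1))) (s≤s γ≤k) ,
    λ x → begin
      wordPerm (γ ∷ʳ a) x        ≡⟨ wordPerm-snoc γ a x ⟩
      wordPerm γ (s a x)         ≡⟨ same (s a x) ⟩
      wordPerm (β ∷ʳ a) (s a x)  ≡⟨ wordPerm-snoc β a (s a x) ⟩
      wordPerm β (s a (s a x))   ≡⟨ cong (wordPerm β) (s-involutive a x) ⟩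
      wordPerm β x               ∎
    where open ≡-Reasoning

  reduced⇒length≤inversions : ∀ α → Letters≤ M α → Reduced α → length α ≤ inversions α
  reduced⇒length≤inversions α bound reduced = ≮⇒≥ λ inv<len →
    let γ , boundγ , γ≤inv , same = shorten (inversions α) α bound refl
    in reduced γ (All.map proj₁ boundγ) (≤-<-trans γ≤inv inv<len) same

  last-letter-ascent : ∀ β a → Letters≤ M (β ∷ʳ a) → length (β ∷ʳ a) ≤ inversions (β ∷ʳ a) →
    wordPerm β a < wordPerm β (suc a) × length β ≤ inversions β
  last-letter-ascent β a bound len≤inv with ∷ʳ⁻ bound
  ... | boundβ , (_ , a≤M) with ascent-or-descent (wordP β) a
  ...   | inj₁ asc = asc , +-cancelʳ-≤ 1 _ _ (begin
    length β + 1            ≡⟨ sym (length-++ β) ⟩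
    length (β ∷ʳ a)         ≤⟨ len≤inv ⟩
    inversions (β ∷ʳ a)     ≡⟨ inversions-ascent β a boundβ a≤M asc ⟩
    inversions β + 1        ∎)
    where open ≤-Reasoning
  ...   | inj₂ desc = ⊥-elim (<-irrefl refl (begin-strict
    length β + 1              ≡⟨ sym (length-++ β) ⟩
    length (β ∷ʳ a)           ≤⟨ len≤inv ⟩
    inversions (β ∷ʳ a)       <⟨ m<m+n _ (s≤s z≤n) ⟩
    inversions (β ∷ʳ a) + 1   ≡⟨ inversions-descent β a boundβ a≤M desc ⟩
    inversions β              ≤⟨ inversions≤length β boundβ ⟩
    length β                  ≤⟨ m≤m+n _ 1 ⟩
    length β + 1              ∎))
    where open ≤-Reasoning

slideAt-new : ∀ p d → slideAt (p + d) p [] ≡ replicate d 0 ++ [ 1 ]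
slideAt-new p d rewrite <ᵇ-true (s≤s (m≤m+n p d)) | m+n∸m≡n p d = refl

slideAt-stack : ∀ p h L → slideAt (p + h) p (h ∷ L) ≡ suc h ∷ L
slideAt-stack p h L rewrite <ᵇ-false (<-irrefl (refl {x = p + h})) | ≡ᵇ-true (refl {x = p + h}) = refl

slideAt-pass : ∀ s p h L → p + h < s → slideAt s p (h ∷ L) ≡ h ∷ slideAt s (suc p) L
slideAt-pass s p h L p+h<s rewrite <ᵇ-true p+h<s = refl

-- The bump branch excludes s = p + h - 1 by this inequality.
m+1<n⇒m<n∸1 : ∀ {m n} → suc m < n → m < n ∸ 1
m+1<n⇒m<n∸1 {n = suc n} (s≤s m<n) = m<n

slideAt-bump : ∀ s p h L → suc s < p + h → slideAt s p (h ∷ L) ≡ h ∷ slideAt (suc s) (suc p) L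
slideAt-bump s p h L s+1<p+h
  rewrite <ᵇ-false (<⇒≯ (<-trans (n<1+n s) s+1<p+h)) | ≡ᵇ-false (<⇒≢ (<-trans (n<1+n s) s+1<p+h))
        | ≡ᵇ-false (<⇒≢ (m+1<n⇒m<n∸1 s+1<p+h)) | ∧-zeroʳ (1 <ᵇ suc h) | <ᵇ-true s+1<p+h = refl

-- A slide beyond the end of the list creates a single cell on the d-th new
-- tower.  Throughout, height L (suc i) is the height of the i-th tower of L
-- counted from 0.
height-replicate : ∀ d i → height (replicate d 0 ++ [ 1 ]) (suc i) ≡ ind (i ≡ᵇ d)
height-replicate zero    zero    = refl
height-replicate zero    (suc i) = refl
height-replicate (suc d) zero    = refl
height-replicate (suc d) (suc i) = height-replicate d i

-- After the
-- end of L all towers are empty, so only passing and stacking are possible.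
data Stacks : ℕ → ℕ → Tower → ℕ → Set where
  stack : ∀ {p h L} → Stacks (p + h) p (h ∷ L) 0
  pass  : ∀ {s p h L d} → p + h < s → Stacks s (suc p) L d → Stacks s p (h ∷ L) (suc d)
  bump  : ∀ {s p h L d} → suc s < p + h → Stacks (suc s) (suc p) L d → Stacks s p (h ∷ L) (suc d)
  new   : ∀ {p d} → Stacks (p + d) p [] d

stacks-height : ∀ {s p L d} → Stacks s p L d →
                ∀ i → height (slideAt s p L) (suc i) ≡ height L (suc i) + ind (i ≡ᵇ d)
stacks-height {p = p} {d = d} new i rewrite slideAt-new p d = height-replicate d i
stacks-height {p = p} {L = h ∷ L} stack zero rewrite slideAt-stack p h L = +-comm 1 h
stacks-height {p = p} {L = h ∷ L} stack (suc i) rewrite slideAt-stack p h L = sym (+-identityʳ _)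
stacks-height {s} {p} {h ∷ L} (pass p+h<s run) zero rewrite slideAt-pass s p h L p+h<s = sym (+-identityʳ h)
stacks-height {s} {p} {h ∷ L} (pass p+h<s run) (suc i) rewrite slideAt-pass s p h L p+h<s = stacks-height run i
stacks-height {s} {p} {h ∷ L} (bump s+1<p+h run) zero rewrite slideAt-bump s p h L s+1<p+h = sym (+-identityʳ h)
stacks-height {s} {p} {h ∷ L} (bump s+1<p+h run) (suc i) rewrite slideAt-bump s p h L s+1<p+h = stacks-height run i

-- The value reaching tower q is  σ q = q + #{i < a | π i ≥ q}: towers q < π a
-- with π⁻¹ q < a are passed, those with π⁻¹ q > a bump the value, and the
-- cell is stacked on tower π a.
module SlideAscent (π : Perm) (a : ℕ) (asc : to π a < to π (suc a)) where

  σ : ℕ → ℕ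
  σ q = q + count≥ (to π) q a

  -- A tower q < π a is passed (π⁻¹ q < a: σ stays) or bumps the value
  -- (π⁻¹ q > a + 1: σ grows by one).
  before-top : ∀ q → q < to π a →
    (q + code π q < σ q × σ (suc q) ≡ σ q) ⊎ (suc (σ q) < q + code π q × σ (suc q) ≡ suc (σ q))
  before-top q q<πa with <-cmp (from π q) a
  ... | tri≈ _ π⁻q≡a _ = ⊥-elim (<⇒≢ q<πa (trans (sym (to-from π q)) (cong (to π) π⁻q≡a)))
  ... | tri< π⁻q<a _ _ = inj₁ (passes , σ-same)
    where
    passes : q + code π q < σ q
    passes = +-monoʳ-< q (count≥-hit< (to π) q (≤-reflexive (sym (to-from π q))) π⁻q<a)
    σ-same : σ (suc q) ≡ σ q
    σ-same = begin
      suc q + count≥ (to π) (suc q) a         ≡⟨ sym (+-suc q _) ⟩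
      q + suc (count≥ (to π) (suc q) a)       ≡⟨ cong (q +_) (+-comm 1 _) ⟩
      q + (count≥ (to π) (suc q) a + 1)       ≡⟨ cong (λ b → q + (count≥ (to π) (suc q) a + ind b)) (sym (<ᵇ-true π⁻q<a)) ⟩
      q + (count≥ (to π) (suc q) a + ind (from π q <ᵇ a)) ≡⟨ cong (q +_) (sym (count≥-split π q a)) ⟩
      σ q                                     ∎
      where open ≡-Reasoning
  ... | tri> _ _ a<π⁻q = inj₂ (bumps , σ-up)
    where
    q<πa+1 : q < to π (suc a)
    q<πa+1 = <-trans q<πa asc
    a+1<π⁻q : suc a < from π q
    a+1<π⁻q = ≤∧≢⇒< a<π⁻q (λ a+1≡π⁻q → <⇒≢ q<πa+1 (trans (sym (to-from π q)) (cong (to π) (sym a+1≡π⁻q))))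
    bumps : suc (σ q) < q + code π q
    bumps = begin-strict
      suc (σ q)                                   <⟨ n<1+n _ ⟩
      suc (suc (q + count≥ (to π) q a))           ≡⟨ cong suc (sym (+-suc q _)) ⟩
      suc (q + suc (count≥ (to π) q a))           ≡⟨ sym (+-suc q _) ⟩
      q + suc (suc (count≥ (to π) q a))           ≡⟨ cong (q +_) (sym hits) ⟩
      q + count≥ (to π) q (suc (suc a))           ≤⟨ +-monoʳ-≤ q (sum<-mono _ a+1<π⁻q) ⟩
      q + code π q                                ∎
      where
      open ≤-Reasoning
      hits : count≥ (to π) q (suc (suc a)) ≡ suc (suc (count≥ (to π) q a))
      hits = trans (count≥-hit (to π) q (suc a) (<⇒≤ q<πa+1)) (cong suc (count≥-hit (to π) q a (<⇒≤ q<πa)))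
    σ-up : σ (suc q) ≡ suc (σ q)
    σ-up = cong suc (cong (q +_) (sym (trans (count≥-split π q a)
             (trans (cong (λ b → count≥ (to π) (suc q) a + ind b) (<ᵇ-false (<⇒≯ a<π⁻q))) (+-identityʳ _)))))

  below-top : ∀ k q → suc k + q ≡ to π a → q < to π a
  below-top k q k+1+q≡πa = subst (q <_) k+1+q≡πa (s≤s (m≤n+m q k))

  at-top : σ (to π a) ≡ to π a + code π (to π a)
  at-top = cong (λ j → to π a + count≥ (to π) (to π a) j) (sym (from-to π a))

  -- Towers after the end of the list are empty; all of them are passed, so
  -- the value arriving there is π a.
  σ-beyond : ∀ k q → k + q ≡ to π a → (∀ i → code π (i + q) ≡ 0) → σ q ≡ to π a
  σ-beyond zero    q refl   empty = trans at-top (trans (cong (q +_) (empty 0)) (+-identityʳ q))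
  σ-beyond (suc k) q k+1+q≡πa empty with before-top q (below-top k q k+1+q≡πa)
  ... | inj₁ (_ , σ-same) =
    trans (sym σ-same) (σ-beyond k (suc q) (trans (+-suc k q) k+1+q≡πa)
                                 (λ i → trans (cong (code π) (+-suc i q)) (empty (suc i))))
  ... | inj₂ (bumps , _) =
    ⊥-elim (<⇒≱ bumps (≤-trans (≤-reflexive (trans (cong (q +_) (empty 0)) (+-identityʳ q)))
                                (≤-trans (m≤m+n q _) (n≤1+n _))))

  slide-run : ∀ k q L → k + q ≡ to π a → (∀ i → height L (suc i) ≡ code π (i + q)) → Stacks (σ q) q L k
  slide-run k q [] k+q≡πa heights =
    subst (λ x → Stacks x q [] k) (sym (trans (σ-beyond k q k+q≡πa (λ i → sym (heights i))) (trans (sym k+q≡πa) (+-comm k q)))) new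
  slide-run zero q (h ∷ L) refl heights =
    subst (λ x → Stacks x q (h ∷ L) 0) (sym (trans at-top (cong (q +_) (sym (heights 0))))) stack
  slide-run (suc k) q (h ∷ L) k+1+q≡πa heights =
    extend (before-top q (below-top k q k+1+q≡πa))
           (slide-run k (suc q) L (trans (+-suc k q) k+1+q≡πa)
                      (λ i → trans (heights (suc i)) (cong (code π) (sym (+-suc i q)))))
    where
    extend : (q + code π q < σ q × σ (suc q) ≡ σ q) ⊎ (suc (σ q) < q + code π q × σ (suc q) ≡ suc (σ q)) →
             Stacks (σ (suc q)) (suc q) L k → Stacks (σ q) q (h ∷ L) (suc k)
    extend (inj₁ (passes , σ-same)) rest =
      pass (subst (λ x → q + x < σ q) (sym (heights 0)) passes) (subst (λ x → Stacks x (suc q) L k) σ-same rest)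
    extend (inj₂ (bumps , σ-up)) rest =
      bump (subst (λ x → suc (σ q) < q + x) (sym (heights 0)) bumps) (subst (λ x → Stacks x (suc q) L k) σ-up rest)

  slide-ascent : to π 0 ≡ 0 → 1 ≤ a → ∀ 𝒯 → (∀ q → 1 ≤ q → height 𝒯 q ≡ code π q) →
                 ∀ q → 1 ≤ q → height (slide a 𝒯) q ≡ height 𝒯 q + ind (q ≡ᵇ to π a)
  slide-ascent to-0 1≤a 𝒯 heights (suc i) _ = begin
    height (slideAt a 1 𝒯) (suc i)          ≡⟨ cong (λ x → height (slideAt x 1 𝒯) (suc i)) (sym σ-start) ⟩
    height (slideAt (σ 1) 1 𝒯) (suc i)      ≡⟨ stacks-height run i ⟩
    height 𝒯 (suc i) + ind (i ≡ᵇ d)         ≡⟨ cong (λ x → height 𝒯 (suc i) + ind (suc i ≡ᵇ x)) d+1≡πa ⟩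
    height 𝒯 (suc i) + ind (suc i ≡ᵇ to π a) ∎
    where
    open ≡-Reasoning
    d : ℕ
    d = to π a ∸ 1
    d+1≡πa : suc d ≡ to π a
    d+1≡πa = trans (+-comm 1 d) (m∸n+n≡m (to-pos π to-0 1≤a))
    σ-start : σ 1 ≡ a
    σ-start = begin
      suc (count≥ (to π) 1 a)              ≡⟨ cong (λ x → suc (count≥ (to π) 1 x)) (sym a′+1≡a) ⟩
      suc (count≥ (to π) 1 (suc (a ∸ 1)))  ≡⟨ cong suc (count≥-one π to-0 (a ∸ 1)) ⟩
      suc (a ∸ 1)                          ≡⟨ a′+1≡a ⟩
      a                                    ∎
      where
      a′+1≡a : suc (a ∸ 1) ≡ a
      a′+1≡a = trans (+-comm 1 (a ∸ 1)) (m∸n+n≡m 1≤a)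
    run : Stacks (σ 1) 1 𝒯 d
    run = slide-run d 1 𝒯 (trans (+-comm d 1) d+1≡πa) (λ i → trans (heights (suc i) (s≤s z≤n)) (cong (code π) (+-comm 1 i)))

-- The heights of the tower diagram of a word are the codes of its permutation,
-- provided the word is no longer than its number of inversions (as reduced
-- words are): every letter is then an ascent, which adds a cell exactly where
-- it adds to the code.
heights-are-codes : ∀ M β → Letters≤ M β → length β ≤ inversions M β →
                    ∀ q → 1 ≤ q → height (towerDiagram β) q ≡ code (wordP β) q
heights-are-codes M β = go (reverseView β)
  where
  go : ∀ {β} → Reverse β → Letters≤ M β → length β ≤ inversions M β →
       ∀ q → 1 ≤ q → height (towerDiagram β) q ≡ code (wordP β) q
  go [] _ _ q _ = sym (code-identity q)
  go (β ∶ r ∶ʳ a) bound len≤inv q 1≤q with ∷ʳ⁻ bound | last-letter-ascent M β a bound len≤inv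
  ... | boundβ , (1≤a , _) | asc , len≤invβ = begin
    height (towerDiagram (β ∷ʳ a)) q                    ≡⟨ cong (λ 𝒯 → height 𝒯 q) (towerDiagram-snoc β a) ⟩
    height (slide a (towerDiagram β)) q                 ≡⟨ slide-ascent (wordPerm-0 β boundβ) 1≤a (towerDiagram β) ih q 1≤q ⟩
    height (towerDiagram β) q + ind (q ≡ᵇ wordPerm β a) ≡⟨ cong (_+ ind (q ≡ᵇ wordPerm β a)) (ih q 1≤q) ⟩
    code (wordP β) q + ind (q ≡ᵇ wordPerm β a)          ≡⟨ sym (code-ascent (wordP β) a asc q) ⟩
    code (wordP β ·s a) q                               ≡⟨ sym (code-snoc β a q) ⟩
    code (wordP (β ∷ʳ a)) q                             ∎
    where
    open ≡-Reasoning
    open SlideAscent (wordP β) a asc using (slide-ascent)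
    ih : ∀ q → 1 ≤ q → height (towerDiagram β) q ≡ code (wordP β) q
    ih = go r boundβ len≤invβ

fn-inside : ∀ 𝒯 A b → b < height 𝒯 (suc A) → fn 𝒯 (suc (suc A)) b ≡ fn 𝒯 (suc A) b
fn-inside 𝒯 A b inside rewrite <ᵇ-true inside = refl

fn-outside : ∀ 𝒯 A b → ¬ b < height 𝒯 (suc A) → fn 𝒯 (suc (suc A)) b ≡ fn 𝒯 (suc A) (suc b)
fn-outside 𝒯 A b outside rewrite <ᵇ-false outside = refl

top-slide≤max : ∀ 𝒯 p k → 1 ≤ height 𝒯 (suc k) → p + k + height 𝒯 (suc k) ∸ 1 ≤ maxTopSlide p 𝒯
top-slide≤max (h ∷ 𝒯) p zero    1≤h rewrite ≡ᵇ-false (>⇒≢ 1≤h) | +-identityʳ p = m≤m⊔n (p + h ∸ 1) _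
top-slide≤max (h ∷ 𝒯) p (suc k) 1≤h rewrite +-suc p k = ≤-trans (top-slide≤max 𝒯 (suc p) k 1≤h) (m≤n⊔m _ _)

tower≤n : ∀ 𝒯 q → 1 ≤ q → 1 ≤ height 𝒯 q → q + height 𝒯 q ≤ nT 𝒯
tower≤n 𝒯 (suc k) _ 1≤h = s≤s (top-slide≤max 𝒯 1 k 1≤h)

module DiagramOfCodes (π : Perm) (to-0 : to π 0 ≡ 0) (𝒯 : Tower)
                      (heights : ∀ q → 1 ≤ q → height 𝒯 q ≡ code π q) where

  flight : ∀ A j → suc A ≤ to π j → fn 𝒯 (suc A) (count≥ (to π) (suc A) j) ≡ j
  flight zero zero 1≤π0 = ⊥-elim (<⇒≢ 1≤π0 (sym to-0))
  flight zero (suc j) _ = cong suc (count≥-one π to-0 j)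
  flight (suc A) j A+2≤πj with <-cmp j (from π (suc A))
  ... | tri≈ _ j≡π⁻ _ = ⊥-elim (<⇒≢ A+2≤πj (sym (trans (cong (to π) j≡π⁻) (to-from π (suc A)))))
  ... | tri< j<π⁻ _ _ = begin
    fn 𝒯 (suc (suc A)) b              ≡⟨ fn-inside 𝒯 A b inside ⟩
    fn 𝒯 (suc A) b                    ≡⟨ cong (fn 𝒯 (suc A)) (sym same) ⟩
    fn 𝒯 (suc A) (count≥ (to π) (suc A) j) ≡⟨ flight A j (≤-trans (n≤1+n _) A+2≤πj) ⟩
    j                                 ∎
    where
    open ≡-Reasoning
    b : ℕ
    b = count≥ (to π) (suc (suc A)) j
    same : count≥ (to π) (suc A) j ≡ b
    same = trans (count≥-split π (suc A) j)
                 (trans (cong (λ x → b + ind x) (<ᵇ-false (<⇒≯ j<π⁻))) (+-identityʳ b))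
    inside : b < height 𝒯 (suc A)
    inside = subst₂ _<_ same (sym (heights (suc A) (s≤s z≤n)))
                    (count≥-hit< (to π) (suc A) (≤-trans (n≤1+n _) A+2≤πj) j<π⁻)
  ... | tri> _ _ π⁻<j = begin
    fn 𝒯 (suc (suc A)) b              ≡⟨ fn-outside 𝒯 A b outside ⟩
    fn 𝒯 (suc A) (suc b)              ≡⟨ cong (fn 𝒯 (suc A)) (sym one-more) ⟩
    fn 𝒯 (suc A) (count≥ (to π) (suc A) j) ≡⟨ flight A j (≤-trans (n≤1+n _) A+2≤πj) ⟩
    j                                 ∎
    where
    open ≡-Reasoning
    b : ℕ
    b = count≥ (to π) (suc (suc A)) j
    one-more : count≥ (to π) (suc A) j ≡ suc b
    one-more = trans (count≥-split π (suc A) j)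
                     (trans (cong (λ x → b + ind x) (<ᵇ-true π⁻<j)) (+-comm b 1))
    outside : ¬ b < height 𝒯 (suc A)
    outside b<h = <⇒≱ b<h (≤-pred (subst₂ _<_ (sym (heights (suc A) (s≤s z≤n))) one-more
                    (count≥-hit< (to π) (suc A) (≤-reflexive (sym (to-from π (suc A)))) π⁻<j)))

  fT≡from : ∀ p → 1 ≤ p → fT 𝒯 p ≡ from π p
  fT≡from (suc A) _ = trans (cong (fn 𝒯 (suc A)) (heights (suc A) (s≤s z≤n)))
                            (flight A (from π (suc A)) (≤-reflexive (sym (to-from π (suc A)))))

  -- No point above n is moved down: if π x < x, tower π x has at least
  -- x - π x cells, so its top cell has slide ≥ x - 1.
  rising-above-n : ∀ x → nT 𝒯 < x → x ≤ to π x
  rising-above-n x n<x = ≮⇒≥ λ πx<x → <⇒≱ n<x (x≤n πx<x)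
    where
    1≤πx : 1 ≤ to π x
    1≤πx = to-pos π to-0 (≤-trans (s≤s z≤n) n<x)
    x≤h+πx : x ≤ height 𝒯 (to π x) + to π x
    x≤h+πx = subst (λ h → x ≤ h + to π x)
                   (sym (trans (heights (to π x) 1≤πx) (cong (count≥ (to π) (to π x)) (from-to π x))))
                   (count≥-lower π (to π x) x)
    x≤n : to π x < x → x ≤ nT 𝒯
    x≤n πx<x = begin
      x                                ≤⟨ x≤h+πx ⟩
      height 𝒯 (to π x) + to π x       ≡⟨ +-comm _ (to π x) ⟩
      to π x + height 𝒯 (to π x)       ≤⟨ tower≤n 𝒯 (to π x) 1≤πx 1≤h ⟩
      nT 𝒯                             ∎
      where
      open ≤-Reasoning
      1≤h : 1 ≤ height 𝒯 (to π x)
      1≤h = n≢0⇒n>0 (λ h≡0 → <⇒≱ πx<x (subst (λ h → x ≤ h + to π x) h≡0 x≤h+πx))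

proposition3p5 : (α : List ℕ) → ValidWord α → Reduced α →
    let T = towerDiagram α
        n = nT T
    in ((p : ℕ) → 1 ≤ p → p ≤ n → (1 ≤ fT T p × fT T p ≤ n))
     × ((k : ℕ) → 1 ≤ k → k ≤ n → Σ[ p ∈ ℕ ] (1 ≤ p × p ≤ n × fT T p ≡ k))
     × ((p q : ℕ) → 1 ≤ p → p ≤ n → 1 ≤ q → q ≤ n → fT T p ≡ fT T q → p ≡ q)
     × ((p : ℕ) → 1 ≤ p → p ≤ n → wordPerm α (fT T p) ≡ p)
     × ((x : ℕ) → n < x → wordPerm α x ≡ x)
proposition3p5 α valid reduced = f-in-range , f-onto , f-injective , ω∘f≡id , fixed
  where
  M : ℕ
  M = sum α
  bound : Letters≤ M α
  bound = letters≤sum α valid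
  ω : Perm
  ω = wordP α
  𝒯 : Tower
  𝒯 = towerDiagram α
  n : ℕ
  n = nT 𝒯
  ω0≡0 : to ω 0 ≡ 0
  ω0≡0 = wordPerm-0 α bound
  open DiagramOfCodes ω ω0≡0 𝒯 (heights-are-codes M α bound (reduced⇒length≤inversions M α bound reduced))

  fixed : ∀ x → n < x → wordPerm α x ≡ x
  fixed = fix-above ω (wordPerm-large α bound) rising-above-n

  f-in-range : ∀ p → 1 ≤ p → p ≤ n → 1 ≤ fT 𝒯 p × fT 𝒯 p ≤ n
  f-in-range p 1≤p p≤n rewrite fT≡from p 1≤p = from-pos ω ω0≡0 1≤p , from-≤ ω fixed p≤n

  f-onto : ∀ k → 1 ≤ k → k ≤ n → Σ[ p ∈ ℕ ] (1 ≤ p × p ≤ n × fT 𝒯 p ≡ k)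
  f-onto k 1≤k k≤n = to ω k , 1≤ωk , to-≤ ω fixed k≤n , trans (fT≡from (to ω k) 1≤ωk) (from-to ω k)
    where
    1≤ωk : 1 ≤ to ω k
    1≤ωk = to-pos ω ω0≡0 1≤k

  ω∘f≡id : ∀ p → 1 ≤ p → p ≤ n → wordPerm α (fT 𝒯 p) ≡ p
  ω∘f≡id p 1≤p _ = trans (cong (to ω) (fT≡from p 1≤p)) (to-from ω p)

  f-injective : ∀ p q → 1 ≤ p → p ≤ n → 1 ≤ q → q ≤ n → fT 𝒯 p ≡ fT 𝒯 q → p ≡ q
  f-injective p q 1≤p p≤n 1≤q q≤n fp≡fq =
    trans (sym (ω∘f≡id p 1≤p p≤n)) (trans (cong (wordPerm α) fp≡fq) (ω∘f≡id q 1≤q q≤n))
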